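{- Let $q,r\geq 3$ be relatively prime integers and let $G$ be a finite, simple, connected graph having at least one cycle of length $q$ and at least one cycle of length $r$. Then $\chi^o(G)=1$.
   Context: All graphs are finite, simple and connected. An oriented edge $[v,w]$ is an edge $\{v,w\}$ with input $v$ and output $w$; $\mathcal{O}=\{[v,w],[w,v]: v\sim w\}$. For $k\geq 1$, $G$ is circularly $k$-partite if $\mathcal{O}$ can be partitioned as $\mathcal{O}=\mathcal{O}_1\sqcup\cdots\sqcup\mathcal{O}_k$ with all $\mathcal{O}_j$ non-empty and such that $[v,w]\in\mathcal{O}_j$ implies $[w,z]\in\mathcal{O}_{j+1}$ for every $z\sim w$ with $z\neq v$, indices modulo $k$. The oriented edge periodic colouring number $\chi^o(G)$ is the largest $k$ such that $G$ is circularly $k$-partite. -}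

module Defs where

open import Data.Nat using (ℕ; zero; suc; _+_; _≤_; _%_)
open import Data.Nat.Coprimality using (Coprime)
open import Data.Fin using (Fin; toℕ)
open import Data.Bool using (Bool; T)
open import Data.Product using (Σ; ∃; ∃-syntax; _×_; _,_)
open import Data.Empty using (⊥)
open import Relation.Nullary using (¬_)
open import Relation.Binary.PropositionalEquality using (_≡_)
open import Function.Definitions using (Injective)

record Graph (n : ℕ) : Set where
  field
    adj     : Fin n → Fin n → Bool
    adj-sym : ∀ v w → adj v w ≡ adj w v
    adj-irr : ∀ v → ¬ T (adj v v)

  -- v ∼ w  (proof-irrelevant, since T b has at most one inhabitant)
  _∼_ : Fin n → Fin n → Set
  v ∼ w = T (adj v w)

open Graph public

data Reachable {n : ℕ} (G : Graph n) : Fin n → Fin n → Set where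
  here : ∀ {v} → Reachable G v v
  step : ∀ {u v w} → _∼_ G u v → Reachable G v w → Reachable G u w

Connected : {n : ℕ} → Graph n → Set
Connected G = ∀ v w → Reachable G v w

HasCycleOfLength : {n : ℕ} → Graph n → ℕ → Set
HasCycleOfLength {n} G zero = ⊥
HasCycleOfLength {n} G (suc m) =
  3 ≤ suc m ×
  Σ (Fin (suc m) → Fin n) λ c →
    Injective _≡_ _≡_ c ×
    (∀ i j → toℕ j ≡ (toℕ i + 1) % suc m → _∼_ G (c i) (c j))

-- G is circularly k-partite: a map from oriented edges [v,w] (v ∼ w) to k
-- classes Fin k (i.e. a partition O = O_1 ⊔ … ⊔ O_k), every class non-empty,
-- such that [v,w] ∈ O_j implies [w,z] ∈ O_{j+1 mod k} for all z ∼ w, z ≠ v.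
CircularlyPartite : {n : ℕ} → Graph n → ℕ → Set
CircularlyPartite {n} G zero = ⊥
CircularlyPartite {n} G (suc m) =
  Σ ((v w : Fin n) → _∼_ G v w → Fin (suc m)) λ col →
    (∀ (j : Fin (suc m)) → ∃[ v ] ∃[ w ] Σ (_∼_ G v w) λ p → col v w p ≡ j) ×
    (∀ v w z (p : _∼_ G v w) (p' : _∼_ G w z) → ¬ (z ≡ v) →
       toℕ (col w z p') ≡ (toℕ (col v w p) + 1) % suc m)

ChiO≡ : {n : ℕ} → Graph n → ℕ → Set
ChiO≡ G k = CircularlyPartite G k × (∀ m → CircularlyPartite G m → m ≤ k)

{-# OPTIONS --safe #-}
module Submission where

open import Defs
open import Data.Nat using (ℕ; zero; suc; _+_; _*_; _%_; _/_; _≤_; NonZero)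
open import Data.Nat.Coprimality using (Coprime)
open import Data.Nat.Properties using (+-assoc; +-comm; +-suc; +-identityʳ; +-cancelˡ-≡; <⇒≱; ≤-reflexive)
open import Data.Nat.DivMod using (m≡m%n+[m/n]*n; [m+kn]%n≡m%n; [m+n]%n≡m%n; m<n⇒m%n≡m; %-congˡ; m%n<n; _mod_)
open import Data.Nat.Divisibility using (_∣_; divides; n∣m*n; ∣m+n∣m⇒∣n; ∣⇒≤)
open import Data.Fin using (Fin; toℕ; zero)
open import Data.Fin.Properties using (toℕ<n; toℕ-fromℕ<; toℕ-injective)
open import Data.Bool.Properties using (T-irrelevant)
open import Data.Product using (_,_)
open import Relation.Nullary using (¬_)
open import Relation.Binary.PropositionalEquality using (_≡_; refl; sym; trans; cong; module ≡-Reasoning)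

-- Walking once around a cycle of length q ≥ 3 never turns back, so the colours
-- of consecutive oriented edges increase by 1 modulo k, and returning to the
-- starting oriented edge after q steps forces k ∣ q.  Hence k divides both q
-- and r, so k = 1; and the constant colouring shows that G is circularly
-- 1-partite.

suc-% : ∀ m d .{{_ : NonZero d}} → suc m % d ≡ (m % d + 1) % d
suc-% m d = begin
  suc m % d                      ≡⟨ %-congˡ (cong suc (m≡m%n+[m/n]*n m d)) ⟩
  (suc (m % d) + m / d * d) % d  ≡⟨ [m+kn]%n≡m%n (suc (m % d)) (m / d) d ⟩
  suc (m % d) % d                ≡⟨ %-congˡ (+-comm 1 (m % d)) ⟩
  (m % d + 1) % d                ∎
  where open ≡-Reasoning

[m+n]%d≡m%d⇒d∣n : ∀ m n d .{{_ : NonZero d}} → (m + n) % d ≡ m % d → d ∣ n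
[m+n]%d≡m%d⇒d∣n m n d eq =
  ∣m+n∣m⇒∣n (divides ((m + n) / d) quotients) (n∣m*n (m / d))
  where
  open ≡-Reasoning
  quotients : m / d * d + n ≡ (m + n) / d * d
  quotients = +-cancelˡ-≡ (m % d) _ _ (begin
    m % d + (m / d * d + n)        ≡⟨ +-assoc (m % d) (m / d * d) n ⟨
    m % d + m / d * d + n          ≡⟨ cong (_+ n) (m≡m%n+[m/n]*n m d) ⟨
    m + n                          ≡⟨ m≡m%n+[m/n]*n (m + n) d ⟩
    (m + n) % d + (m + n) / d * d  ≡⟨ cong (_+ (m + n) / d * d) eq ⟩
    m % d + (m + n) / d * d        ∎)

toℕ-mod : ∀ m d .{{_ : NonZero d}} → toℕ (m mod d) ≡ m % d
toℕ-mod m d = toℕ-fromℕ< (m%n<n m d)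

oriented-edge-cong : ∀ {n} {A : Set} (G : Graph n) (f : ∀ v w → _∼_ G v w → A)
                     {v v′ w w′} → v ≡ v′ → w ≡ w′ →
                     (p : _∼_ G v w) (p′ : _∼_ G v′ w′) → f v w p ≡ f v′ w′ p′
oriented-edge-cong G f refl refl p p′ = cong (f _ _) (T-irrelevant p p′)

record PeriodicNonBacktrackingWalk {n} (G : Graph n) (q : ℕ) : Set where
  field
    vertex           : ℕ → Fin n
    edge             : ∀ i → _∼_ G (vertex i) (vertex (suc i))
    non-backtracking : ∀ i → ¬ (vertex (2 + i) ≡ vertex i)
    periodic         : ∀ i → vertex (i + q) ≡ vertex i

module _ {n} {G : Graph n} {q} (W : PeriodicNonBacktrackingWalk G q) where
  open PeriodicNonBacktrackingWalk W

  partite-∣-period : ∀ {k} → CircularlyPartite G k → k ∣ q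
  partite-∣-period {suc k} (col , _ , successor) =
    [m+n]%d≡m%d⇒d∣n (colour 0) q (suc k) (begin
      (colour 0 + q) % suc k  ≡⟨ colour-≡ q ⟨
      colour q                ≡⟨ colour-periodic ⟩
      colour 0                ≡⟨ colour0-% ⟨
      colour 0 % suc k        ∎)
    where
    open ≡-Reasoning

    colour : ℕ → ℕ
    colour i = toℕ (col (vertex i) (vertex (suc i)) (edge i))

    colour0-% : colour 0 % suc k ≡ colour 0
    colour0-% = m<n⇒m%n≡m (toℕ<n (col _ _ (edge 0)))

    colour-≡ : ∀ i → colour i ≡ (colour 0 + i) % suc k
    colour-≡ zero = trans (sym colour0-%) (%-congˡ (sym (+-identityʳ (colour 0))))
    colour-≡ (suc i) = begin
      colour (suc i)                          ≡⟨ successor _ _ _ (edge i) (edge (suc i)) (non-backtracking i) ⟩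
      (colour i + 1) % suc k                  ≡⟨ cong (λ c → (c + 1) % suc k) (colour-≡ i) ⟩
      ((colour 0 + i) % suc k + 1) % suc k    ≡⟨ suc-% (colour 0 + i) (suc k) ⟨
      suc (colour 0 + i) % suc k              ≡⟨ %-congˡ (+-suc (colour 0) i) ⟨
      (colour 0 + suc i) % suc k              ∎

    colour-periodic : colour q ≡ colour 0
    colour-periodic = cong toℕ (oriented-edge-cong G col (periodic 0) (periodic 1) (edge q) (edge 0))

cycle⇒walk : ∀ {n} {G : Graph n} {q} → HasCycleOfLength G q → PeriodicNonBacktrackingWalk G q
cycle⇒walk {G = G} {suc m} (3≤q , c , c-injective , c-adjacent) = record
  { vertex           = λ i → c (i mod q)
  ; edge             = edge
  ; non-backtracking = non-backtracking
  ; periodic         = λ i → cong c (toℕ-injective (begin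
      toℕ ((i + q) mod q)  ≡⟨ toℕ-mod (i + q) q ⟩
      (i + q) % q          ≡⟨ [m+n]%n≡m%n i q ⟩
      i % q                ≡⟨ toℕ-mod i q ⟨
      toℕ (i mod q)        ∎))
  }
  where
  open ≡-Reasoning
  q = suc m

  edge : ∀ i → _∼_ G (c (i mod q)) (c (suc i mod q))
  edge i = c-adjacent (i mod q) (suc i mod q) (begin
    toℕ (suc i mod q)        ≡⟨ toℕ-mod (suc i) q ⟩
    suc i % q                ≡⟨ suc-% i q ⟩
    (i % q + 1) % q          ≡⟨ cong (λ j → (j + 1) % q) (toℕ-mod i q) ⟨
    (toℕ (i mod q) + 1) % q  ∎)

  non-backtracking : ∀ i → ¬ (c ((2 + i) mod q) ≡ c (i mod q))
  non-backtracking i eq = <⇒≱ 3≤q (∣⇒≤ ([m+n]%d≡m%d⇒d∣n i 2 q (begin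
    (i + 2) % q          ≡⟨ %-congˡ (+-comm i 2) ⟩
    (2 + i) % q          ≡⟨ toℕ-mod (2 + i) q ⟨
    toℕ ((2 + i) mod q)  ≡⟨ cong toℕ (c-injective eq) ⟩
    toℕ (i mod q)        ≡⟨ toℕ-mod i q ⟩
    i % q                ∎)))

edge⇒circularly-1-partite : ∀ {n} {G : Graph n} {v w} → _∼_ G v w → CircularlyPartite G 1
edge⇒circularly-1-partite {v = v} {w} p =
  (λ _ _ _ → zero) , (λ { zero → v , w , p , refl }) , (λ _ _ _ _ _ _ → refl)

lemma3p2 : (q r : ℕ) → 3 ≤ q → 3 ≤ r → Coprime q r → (n : ℕ) → (G : Graph n) → Connected G → HasCycleOfLength G q → HasCycleOfLength G r → ChiO≡ G 1
lemma3p2 q r _ _ q⊥r n G _ q-cycle r-cycle =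
  edge⇒circularly-1-partite {G = G} (edge 0) ,
  λ k k-partite → ≤-reflexive (q⊥r (partite-∣-period q-walk k-partite , partite-∣-period r-walk k-partite))
  where
  q-walk : PeriodicNonBacktrackingWalk G q
  q-walk = cycle⇒walk q-cycle
  r-walk : PeriodicNonBacktrackingWalk G r
  r-walk = cycle⇒walk r-cycle
  open PeriodicNonBacktrackingWalk q-walk using (edge)
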